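{- Let $n\ge m\ge 3$. Then $$\mu_{\rm t}(C_n\,\square\,C_m)=\begin{cases}3, & (n,m)\in\{(3,3),(4,3)\},\\ 4, & (n,m)=(4,4),\\ 0, & \text{otherwise}.\end{cases}$$
   Context: $C_n$ is the cycle on $n$ vertices and $C_n\,\square\,C_m$ is the Cartesian product (torus graph). For a graph $G$ and $X\subseteq V(G)$, vertices $u,v\in V(G)$ are $X$-visible if there exists a shortest $u,v$-path $P$ with $V(P)\cap X\subseteq\{u,v\}$. $X$ is a total mutual-visibility set if every two vertices of $V(G)$ are $X$-visible; $\mu_{\rm t}(G)$ is the maximum cardinality of a total mutual-visibility set of $G$ (the empty set is allowed, so the value may be $0$). -}

module Defs where

open import Data.Nat using (ℕ; zero; suc; _+_; _≤_)
open import Data.Fin using (Fin; toℕ)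
open import Data.Product using (_×_; _,_; Σ; ∃)
open import Data.Sum using (_⊎_)
open import Data.List using (List; []; _∷_; length)
open import Data.List.Membership.Propositional using (_∈_)
open import Data.List.Relation.Unary.Unique.Propositional using (Unique)
open import Relation.Binary.PropositionalEquality using (_≡_)

record Graph : Set₁ where
  field
    V   : Set
    Adj : V → V → Set
open Graph public

data Walk (G : Graph) : V G → V G → Set where
  stop : (u : V G) → Walk G u u
  step : {u w v : V G} → Adj G u w → Walk G w v → Walk G u v

len : {G : Graph} {u v : V G} → Walk G u v → ℕ
len (stop _)   = 0
len (step _ p) = suc (len p)

verts : {G : Graph} {u v : V G} → Walk G u v → List (V G)
verts (stop u)            = u ∷ []
verts (step {u = u} _ p)  = u ∷ verts p

IsPath : {G : Graph} {u v : V G} → Walk G u v → Set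
IsPath p = Unique (verts p)

IsShortestPath : {G : Graph} {u v : V G} → Walk G u v → Set
IsShortestPath {G} {u} {v} p = IsPath p × ((q : Walk G u v) → len p ≤ len q)

Visible : (G : Graph) → List (V G) → V G → V G → Set
Visible G X u v =
  Σ (Walk G u v) λ p → IsShortestPath p ×
    ((x : V G) → x ∈ verts p → x ∈ X → (x ≡ u ⊎ x ≡ v))

IsTotalMutVis : (G : Graph) → List (V G) → Set
IsTotalMutVis G X = Unique X × ((u v : V G) → Visible G X u v)

IsMuT : Graph → ℕ → Set
IsMuT G k =
  (Σ (List (V G)) λ X → IsTotalMutVis G X × length X ≡ k) ×
  ((X : List (V G)) → IsTotalMutVis G X → length X ≤ k)

CycleAdj : (n : ℕ) → Fin n → Fin n → Set
CycleAdj n i j =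
  suc (toℕ i) ≡ toℕ j ⊎ suc (toℕ j) ≡ toℕ i ⊎
  (toℕ i ≡ 0 × suc (toℕ j) ≡ n) ⊎ (toℕ j ≡ 0 × suc (toℕ i) ≡ n)

Cycle : ℕ → Graph
Cycle n = record { V = Fin n ; Adj = CycleAdj n }

_□_ : Graph → Graph → Graph
G □ H = record
  { V   = V G × V H
  ; Adj = λ { (g , h) (g' , h') → (g ≡ g' × Adj H h h') ⊎ (Adj G g g' × h ≡ h') }
  }

expected : ℕ → ℕ → ℕ
expected 3 3 = 3
expected 4 3 = 3
expected 4 4 = 4
expected _ _ = 0

-- The graph distance of C_n □ C_m is the sum of the cyclic distances min(t, n - t) of
-- the coordinates; it is certified by a potential that drops by at most one along every
-- edge and by exactly one along some edge towards any target.  For n ≥ 5 every vertex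
-- (a , b) is the only common neighbour of (a - 1 , b) and (a + 1 , b), which are at
-- distance two, so a total mutual-visibility set contains no vertex at all.  The three
-- small tori are settled by computation: a search for distance-bounded walks decides
-- visibility, which certifies the optimal sets, and a clique bound for the relation
-- "a and b do not block each other's probe pairs" gives the matching upper bounds.
module Submission where

open import Defs
open import Data.Nat using (ℕ; zero; suc; _+_; _∸_; _⊓_; _≤_; _<_; _≤?_; _<?_; z≤n; s≤s)
open import Data.Nat.Properties
open import Data.Fin using (Fin; toℕ; fromℕ<; fromℕ; inject₁; #_) renaming (zero to fzero; suc to fsuc)
import Data.Fin.Properties as Fin
open import Data.Fin.Properties using (toℕ<n; toℕ-fromℕ<; toℕ-fromℕ; toℕ-inject₁; toℕ-injective)
open import Data.Product using (_×_; _,_; Σ; proj₁; proj₂)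
open import Data.Product.Properties using (≡-dec)
open import Data.Sum using (_⊎_; inj₁; inj₂)
open import Data.Empty using (⊥-elim)
open import Data.List using (List; []; _∷_; length; filter; cartesianProduct; allFin)
open import Data.List.Membership.Propositional using (_∈_; find; lose)
open import Data.List.Relation.Unary.Any using (Any; here; there; any?)
open import Data.List.Relation.Unary.All as All using (All; []; _∷_)
open import Data.List.Relation.Unary.AllPairs using (AllPairs; []; _∷_)
open import Data.List.Membership.Propositional.Properties
  using (∈-filter⁺; ∈-cartesianProduct⁺; ∈-allFin)
open import Data.List.Relation.Unary.Unique.Propositional using (Unique)
open import Relation.Nullary using (¬_; Dec; yes; no; map′; ¬?; _×-dec_; _⊎-dec_; _→-dec_)
open import Relation.Nullary.Decidable using (True; toWitness)
open import Relation.Unary using (Decidable)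
open import Relation.Binary.Definitions using (DecidableEquality)
open import Relation.Binary.PropositionalEquality
open import Function using (_∘_; id)

-- Walks, distance potentials and visibility

module BoundedWalks (G : Graph) (_≟_ : DecidableEquality (V G)) (neighbours : V G → List (V G))
                    (neighbours-sound : ∀ {u w} → w ∈ neighbours u → Adj G u w)
                    (neighbours-complete : ∀ {u w} → Adj G u w → w ∈ neighbours u) where

  WalkWithin : (V G → Set) → ℕ → V G → V G → Set
  WalkWithin P k u v = Σ (Walk G u v) λ p → len p ≤ k × All P (verts p)

  walkWithin? : ∀ {P} → Decidable P → ∀ k u v → Dec (WalkWithin P k u v)
  walkWithin? {P} P? zero u v = map′ stay stayed (P? u ×-dec u ≟ v)
    where
    stay : P u × u ≡ v → WalkWithin P zero u v
    stay (Pu , refl) = stop u , z≤n , Pu ∷ []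
    stayed : WalkWithin P zero u v → P u × u ≡ v
    stayed (stop _ , _ , Pu ∷ []) = Pu , refl
  walkWithin? {P} P? (suc k) u v =
    map′ walk walked (P? u ×-dec (u ≟ v ⊎-dec any? (λ w → walkWithin? P? k w v) (neighbours u)))
    where
    Unfolded = P u × (u ≡ v ⊎ Any (λ w → WalkWithin P k w v) (neighbours u))
    walk : Unfolded → WalkWithin P (suc k) u v
    walk (Pu , inj₁ refl)  = stop u , z≤n , Pu ∷ []
    walk (Pu , inj₂ later) =
      let _ , w∈ , p , len≤k , Pp = find later in step (neighbours-sound w∈) p , s≤s len≤k , Pu ∷ Pp
    walked : WalkWithin P (suc k) u v → Unfolded
    walked (stop _    , _         , Pu ∷ [])  = Pu , inj₁ refl
    walked (step uw p , s≤s len≤k , Pu ∷ Pp) =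
      Pu , inj₂ (lose (neighbours-complete uw) (p , len≤k , Pp))

module Potential (G : Graph) (d : V G → V G → ℕ)
                 (d-refl : ∀ v → d v v ≡ 0)
                 (d-edge : ∀ {u w} v → Adj G u w → d u v ≤ suc (d w v)) where

  d≤len : ∀ {u v} (p : Walk G u v) → d u v ≤ len p
  d≤len (stop v)             = ≤-reflexive (d-refl v)
  d≤len {v = v} (step uw p) = ≤-trans (d-edge v uw) (s≤s (d≤len p))

  ∈verts⇒d≤len : ∀ {u v x} (p : Walk G u v) → x ∈ verts p → d x v ≤ len p
  ∈verts⇒d≤len (stop v)    (here refl) = ≤-reflexive (d-refl v)
  ∈verts⇒d≤len (step uw p) (here refl) = d≤len (step uw p)
  ∈verts⇒d≤len (step uw p) (there x∈p) = ≤-trans (∈verts⇒d≤len p x∈p) (n≤1+n (len p))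

  len≡d⇒IsPath : ∀ {u v} (p : Walk G u v) → len p ≡ d u v → IsPath p
  len≡d⇒IsPath (stop v) _ = [] ∷ []
  len≡d⇒IsPath {u} {v} (step {w = w} uw p) len≡d = All.tabulate u∉p ∷ len≡d⇒IsPath p len-p≡d
    where
    len-p≡d : len p ≡ d w v
    len-p≡d = ≤-antisym (≤-pred (subst (_≤ suc (d w v)) (sym len≡d) (d-edge v uw))) (d≤len p)
    u∉p : ∀ {x} → x ∈ verts p → u ≢ x
    u∉p x∈p refl = 1+n≰n (subst (_≤ len p) (sym len≡d) (∈verts⇒d≤len p x∈p))

  len≤d⇒IsShortestPath : ∀ {u v} (p : Walk G u v) → len p ≤ d u v → IsShortestPath p
  len≤d⇒IsShortestPath p len≤d =
    len≡d⇒IsPath p (≤-antisym len≤d (d≤len p)) , λ q → ≤-trans len≤d (d≤len q)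

  -- If every vertex other than v moreover has a neighbour closer to v, d is the graph distance.
  module Geodesics (_≟_ : DecidableEquality (V G))
                   (d-descent : ∀ u v → u ≢ v → Σ (V G) λ w → Adj G u w × suc (d w v) ≡ d u v) where

    geodesic : ∀ k u v → d u v ≡ k → Σ (Walk G u v) λ p → len p ≡ k
    geodesic k u v d≡k with u ≟ v
    ... | yes refl = stop u , trans (sym (d-refl u)) d≡k
    ... | no  u≢v with d-descent u v u≢v | k
    ...   | w , uw , closer | zero  = ⊥-elim (1+n≢0 (trans closer d≡k))
    ...   | w , uw , closer | suc k′ =
      let p , len-p = geodesic k′ w v (suc-injective (trans closer d≡k))
      in step uw p , cong suc len-p

    shortestPath : ∀ u v → Σ (Walk G u v) IsShortestPath
    shortestPath u v =
      let p , len-p = geodesic (d u v) u v refl in p , len≤d⇒IsShortestPath p (≤-reflexive len-p)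

    module _ (neighbours : V G → List (V G))
             (neighbours-sound : ∀ {u w} → w ∈ neighbours u → Adj G u w)
             (neighbours-complete : ∀ {u w} → Adj G u w → w ∈ neighbours u) where
      open BoundedWalks G _≟_ neighbours neighbours-sound neighbours-complete
      open import Data.List.Membership.DecPropositional _≟_ using (_∈?_)

      visible? : ∀ X u v → Dec (Visible G X u v)
      visible? X u v = map′ visible walkWithin
        (walkWithin? (λ x → x ∈? X →-dec (x ≟ u ⊎-dec x ≟ v)) (d u v) u v)
        where
        visible : WalkWithin (λ x → x ∈ X → x ≡ u ⊎ x ≡ v) (d u v) u v → Visible G X u v
        visible (p , len≤d , avoids) = p , len≤d⇒IsShortestPath p len≤d , λ _ → All.lookup avoids
        walkWithin : Visible G X u v → WalkWithin (λ x → x ∈ X → x ≡ u ⊎ x ≡ v) (d u v) u v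
        walkWithin (p , (_ , shortest) , avoids) =
          let q , len-q = geodesic (d u v) u v refl
          in p , ≤-trans (shortest q) (≤-reflexive len-q) , All.tabulate (avoids _)

record UniqueMiddle (G : Graph) (u x v : V G) : Set where
  field
    ends-distinct : u ≢ v
    ends-nonadj   : ¬ Adj G u v
    left          : Adj G u x
    right         : Adj G x v
    unique        : ∀ w → Adj G u w → Adj G w v → w ≡ x
open UniqueMiddle

short-walk-middle : ∀ {G : Graph} {u v} (p : Walk G u v) → len p ≤ 2 → u ≢ v → ¬ Adj G u v →
                    Σ (V G) λ w → Adj G u w × Adj G w v × w ∈ verts p
short-walk-middle (stop _)                     _               u≢v _   = ⊥-elim (u≢v refl)
short-walk-middle (step uv (stop _))           _               _   ¬uv = ⊥-elim (¬uv uv)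
short-walk-middle (step uw (step wv (stop _))) _               _   _   = _ , uw , wv , there (here refl)
short-walk-middle (step _ (step _ (step _ _))) (s≤s (s≤s ())) _   _

UniqueMiddle⇒¬Visible : ∀ {G X u x v} → UniqueMiddle G u x v → x ∈ X → ¬ Visible G X u v
UniqueMiddle⇒¬Visible {v = v} m x∈X (p , (_ , shortest) , avoids)
  with short-walk-middle p (shortest (step (left m) (step (right m) (stop v))))
                          (ends-distinct m) (ends-nonadj m)
... | w , uw , wv , w∈p with unique m w uw wv
...   | refl with avoids w w∈p x∈X
...     | inj₁ refl = ends-nonadj m (right m)
...     | inj₂ refl = ends-nonadj m (left m)

Visible-antitone : ∀ {G X Y u v} → (∀ {x} → x ∈ Y → x ∈ X) → Visible G X u v → Visible G Y u v
Visible-antitone Y⊆X (p , shortest , avoids) = p , shortest , λ x x∈p x∈Y → avoids x x∈p (Y⊆X x∈Y)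

IsMuT-zero : ∀ {G} → (∀ u v → Σ (Walk G u v) IsShortestPath) →
             (∀ x → Σ (V G) λ u → Σ (V G) λ v → UniqueMiddle G u x v) → IsMuT G 0
IsMuT-zero {G} shortestPath uniqueMiddle = ([] , ([] , empty-visible) , refl) , bound
  where
  empty-visible : ∀ u v → Visible G [] u v
  empty-visible u v = let p , shortest = shortestPath u v in p , shortest , λ _ _ ()
  bound : ∀ X → IsTotalMutVis G X → length X ≤ 0
  bound []      _            = z≤n
  bound (x ∷ _) (_ , visible) =
    let u , v , m = uniqueMiddle x in ⊥-elim (UniqueMiddle⇒¬Visible m (here refl) (visible u v))

□-UniqueMiddle : ∀ {G H u x v} h → UniqueMiddle G u x v → ¬ Adj H h h →
                 UniqueMiddle (G □ H) (u , h) (x , h) (v , h)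
□-UniqueMiddle {G} {H} {u} {x} {v} h m ¬hh = record
  { ends-distinct = λ uh≡vh → ends-distinct m (cong proj₁ uh≡vh)
  ; ends-nonadj   = λ { (inj₁ (u≡v , _)) → ends-distinct m u≡v
                      ; (inj₂ (uv , _))  → ends-nonadj m uv }
  ; left          = inj₂ (left m , refl)
  ; right         = inj₂ (right m , refl)
  ; unique        = unique′
  }
  where
  unique′ : ∀ w → Adj (G □ H) (u , h) w → Adj (G □ H) w (v , h) → w ≡ (x , h)
  unique′ _       (inj₁ (refl , _))  (inj₁ (u≡v , _))  = ⊥-elim (ends-distinct m u≡v)
  unique′ _       (inj₁ (_ , hh))    (inj₂ (_ , refl)) = ⊥-elim (¬hh hh)
  unique′ _       (inj₂ (_ , refl))  (inj₁ (_ , hh))   = ⊥-elim (¬hh hh)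
  unique′ (w , _) (inj₂ (uw , refl)) (inj₂ (wv , _))   = cong (_, h) (unique m w uw wv)

module _ {G H : Graph} (dG : V G → V G → ℕ) (dH : V H → V H → ℕ) where

  □-dist : V (G □ H) → V (G □ H) → ℕ
  □-dist (g , h) (g′ , h′) = dG g g′ + dH h h′

  □-dist-refl : (∀ g → dG g g ≡ 0) → (∀ h → dH h h ≡ 0) → ∀ v → □-dist v v ≡ 0
  □-dist-refl dG-refl dH-refl (g , h) = cong₂ _+_ (dG-refl g) (dH-refl h)

  □-dist-edge : (∀ {g g′} g″ → Adj G g g′ → dG g g″ ≤ suc (dG g′ g″)) →
                (∀ {h h′} h″ → Adj H h h′ → dH h h″ ≤ suc (dH h′ h″)) →
                ∀ {u w} v → Adj (G □ H) u w → □-dist u v ≤ suc (□-dist w v)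
  □-dist-edge _      dH-edge {g , h} {_ , h′} (g″ , h″) (inj₁ (refl , hh′)) =
    subst (dG g g″ + dH h h″ ≤_) (+-suc (dG g g″) (dH h′ h″)) (+-monoʳ-≤ (dG g g″) (dH-edge h″ hh′))
  □-dist-edge dG-edge _      {g , h} {g′ , _} (g″ , h″) (inj₂ (gg′ , refl)) =
    +-monoˡ-≤ (dH h h″) (dG-edge g″ gg′)

  □-dist-descent : DecidableEquality (V G) →
                   (∀ g g′ → g ≢ g′ → Σ (V G) λ g₁ → Adj G g g₁ × suc (dG g₁ g′) ≡ dG g g′) →
                   (∀ h h′ → h ≢ h′ → Σ (V H) λ h₁ → Adj H h h₁ × suc (dH h₁ h′) ≡ dH h h′) →
                   ∀ u v → u ≢ v →
                   Σ (V (G □ H)) λ w → Adj (G □ H) u w × suc (□-dist w v) ≡ □-dist u v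
  □-dist-descent _≟_ dG-descent dH-descent (g , h) (g′ , h′) u≢v with g ≟ g′
  ... | no g≢g′ = let g₁ , gg₁ , closer = dG-descent g g′ g≢g′ in
    (g₁ , h) , inj₂ (gg₁ , refl) , cong (_+ dH h h′) closer
  ... | yes refl = let h₁ , hh₁ , closer = dH-descent h h′ (λ h≡h′ → u≢v (cong (g ,_) h≡h′)) in
    (g , h₁) , inj₁ (refl , hh₁) , trans (sym (+-suc (dG g g) (dH h₁ h′))) (cong (dG g g +_) closer)

module Cliques {A : Set} {R : A → A → Set} (R? : ∀ x y → Dec (R x y)) where

  CliquesAtMost : ℕ → List A → Set
  CliquesAtMost zero    S = S ≡ []
  CliquesAtMost (suc k) S = All (λ x → CliquesAtMost k (filter (R? x) S)) S

  cliquesAtMost? : ∀ k S → Dec (CliquesAtMost k S)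
  cliquesAtMost? zero    []      = yes refl
  cliquesAtMost? zero    (_ ∷ _) = no λ ()
  cliquesAtMost? (suc k) S       = All.all? (λ x → cliquesAtMost? k (filter (R? x) S)) S

  clique-length≤ : ∀ {k S} X → CliquesAtMost k S → (∀ {x} → x ∈ X → x ∈ S) → AllPairs R X →
                   length X ≤ k
  clique-length≤         []      _       _   _ = z≤n
  clique-length≤ {zero}  (x ∷ X) refl    X⊆S _ with () ← X⊆S (here refl)
  clique-length≤ {suc k} (x ∷ X) bounded X⊆S (Rx ∷ clique) =
    s≤s (clique-length≤ X (All.lookup bounded (X⊆S (here refl)))
           (λ y∈X → ∈-filter⁺ (R? x) (X⊆S (there y∈X)) (All.lookup Rx y∈X)) clique)

module DecidableMuT (G : Graph) (_≟_ : DecidableEquality (V G))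
                    (vertices : List (V G)) (∈vertices : ∀ v → v ∈ vertices)
                    (visible? : ∀ X u v → Dec (Visible G X u v))
                    (probes : V G → V G → List (V G × V G)) where
  open import Data.List.Relation.Unary.Unique.DecPropositional _≟_ using (unique?)

  Compatible : V G → V G → Set
  Compatible a b = a ≢ b × All (λ (u , v) → Visible G (a ∷ b ∷ []) u v) (probes a b)

  compatible? : ∀ a b → Dec (Compatible a b)
  compatible? a b = ¬? (a ≟ b) ×-dec All.all? (λ (u , v) → visible? (a ∷ b ∷ []) u v) (probes a b)

  IsTotalMutVis⇒clique : ∀ {X} → IsTotalMutVis G X → AllPairs Compatible X
  IsTotalMutVis⇒clique {X} (unique , visible) = clique id unique
    where
    clique : ∀ {Y} → (∀ {y} → y ∈ Y → y ∈ X) → Unique Y → AllPairs Compatible Y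
    clique {[]}    _   []             = []
    clique {y ∷ Y} Y⊆X (y≢Y ∷ unique) =
      All.tabulate (λ z∈Y → All.lookup y≢Y z∈Y ,
                            All.tabulate λ _ → Visible-antitone (pair⊆X z∈Y) (visible _ _))
      ∷ clique (Y⊆X ∘ there) unique
      where
      pair⊆X : ∀ {z x} → z ∈ Y → x ∈ y ∷ z ∷ [] → x ∈ X
      pair⊆X _   (here refl)         = Y⊆X (here refl)
      pair⊆X z∈Y (there (here refl)) = Y⊆X (there z∈Y)

  allVisible? : ∀ X → Dec (∀ u v → Visible G X u v)
  allVisible? X = map′ (λ vis u v → All.lookup (All.lookup vis (∈vertices u)) (∈vertices v))
                       (λ vis → All.tabulate λ _ → All.tabulate λ _ → vis _ _)
                       (All.all? (λ u → All.all? (visible? X u) vertices) vertices)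

  isTotalMutVis? : ∀ X → Dec (IsTotalMutVis G X)
  isTotalMutVis? X = unique? X ×-dec allVisible? X

  open Cliques compatible?

  IsMuT-bySearch : ∀ X → True (isTotalMutVis? X) → True (cliquesAtMost? (length X) vertices) →
                   IsMuT G (length X)
  IsMuT-bySearch X mutVis bounded =
    (X , toWitness mutVis , refl) ,
    λ Y Y-mutVis → clique-length≤ Y (toWitness bounded) (λ {y} _ → ∈vertices y)
                                    (IsTotalMutVis⇒clique Y-mutVis)

-- The cycle 0 → 1 → ⋯ → n - 1 → 0 of numbers

m∸n≡1+[m∸1+n] : ∀ {m n} → suc n ≤ m → m ∸ n ≡ suc (m ∸ suc n)
m∸n≡1+[m∸1+n] {suc m} {n} (s≤s n≤m) = +-∸-assoc 1 n≤m

CycleStep : ℕ → ℕ → ℕ → Set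
CycleStep n x y = suc x ≡ y ⊎ (suc x ≡ n × y ≡ 0)

CycleNeighbours : ℕ → ℕ → ℕ → Set
CycleNeighbours n x y = CycleStep n x y ⊎ CycleStep n y x

forward : ℕ → ℕ → ℕ → ℕ
forward n x k with x ≤? k
... | yes _ = k ∸ x
... | no  _ = n ∸ x + k

forward-self : ∀ n x → forward n x x ≡ 0
forward-self n x with x ≤? x
... | yes _   = n∸n≡0 x
... | no  x≰x = ⊥-elim (x≰x ≤-refl)

forward≡0⇒≡ : ∀ {n x k} → x < n → forward n x k ≡ 0 → x ≡ k
forward≡0⇒≡ {n} {x} {k} x<n e with x ≤? k
... | yes x≤k = ≤-antisym x≤k (m∸n≡0⇒m≤n e)
... | no  _   = ⊥-elim (<⇒≱ x<n (m∸n≡0⇒m≤n (m+n≡0⇒m≡0 (n ∸ x) e)))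

forward<n : ∀ {n x k} → x < n → k < n → forward n x k < n
forward<n {n} {x} {k} x<n k<n with x ≤? k
... | yes _   = ≤-<-trans (m∸n≤m k x) k<n
... | no  x≰k = begin-strict
  n ∸ x + k <⟨ +-monoʳ-< (n ∸ x) (≰⇒> x≰k) ⟩
  n ∸ x + x ≡⟨ m∸n+n≡m (<⇒≤ x<n) ⟩
  n         ∎
  where open ≤-Reasoning

forward-step : ∀ {n x y} k → CycleStep n x y → y < n → k < n →
               CycleStep n (forward n y k) (forward n x k)
forward-step {n} {x} k (inj₁ refl) y<n k<n with x ≤? k | suc x ≤? k
... | yes _   | yes x<k = inj₁ (sym (m∸n≡1+[m∸1+n] x<k))
... | yes x≤k | no  x≮k = inj₂ (around , m≤n⇒m∸n≡0 (≤-pred (≰⇒> x≮k)))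
  where
  around : suc (n ∸ suc x + k) ≡ n
  around rewrite ≤-antisym (≤-pred (≰⇒> x≮k)) x≤k =
    trans (sym (+-suc (n ∸ suc x) x)) (m∸n+n≡m (<⇒≤ y<n))
... | no  x≰k | yes x<k = ⊥-elim (x≰k (<⇒≤ x<k))
... | no  _   | no  _   = inj₁ (cong (_+ k) (sym (m∸n≡1+[m∸1+n] (<⇒≤ y<n))))
forward-step {n} {x} k (inj₂ (refl , refl)) _ k<n with x ≤? k
... | yes x≤k = inj₂ (cong suc (≤-antisym (≤-pred k<n) x≤k) , m≤n⇒m∸n≡0 (≤-pred k<n))
... | no  _   = inj₁ (cong (_+ k) (sym (m+n∸n≡m 1 x)))

forward-neighbours : ∀ {n x y} k → CycleNeighbours n x y → x < n → y < n → k < n →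
                     CycleNeighbours n (forward n x k) (forward n y k)
forward-neighbours k (inj₁ s) _   y<n k<n = inj₂ (forward-step k s y<n k<n)
forward-neighbours k (inj₂ s) x<n _   k<n = inj₁ (forward-step k s x<n k<n)

shorterArc : ℕ → ℕ → ℕ
shorterArc n t = t ⊓ (n ∸ t)

shorterArc-step : ∀ {n s t} → CycleStep n s t → t < n →
                  shorterArc n s ≤ suc (shorterArc n t) × shorterArc n t ≤ suc (shorterArc n s)
shorterArc-step {n} {s} (inj₁ refl) t<n =
  subst (shorterArc n s ≤_) (cong (suc (suc s) ⊓_) (m∸n≡1+[m∸1+n] (<⇒≤ t<n)))
    (⊓-mono-≤ (≤-trans (n≤1+n s) (n≤1+n (suc s))) ≤-refl) ,
  ⊓-mono-≤ ≤-refl (≤-trans (∸-monoʳ-≤ n (n≤1+n s)) (n≤1+n (n ∸ s)))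
shorterArc-step {s = s} (inj₂ (refl , refl)) _ =
  subst (s ⊓ (suc s ∸ s) ≤_) (m+n∸n≡m 1 s) (m⊓n≤n s (suc s ∸ s)) , z≤n

shorterArc-neighbours : ∀ {n s t} → CycleNeighbours n s t → s < n → t < n →
                        shorterArc n s ≤ suc (shorterArc n t)
shorterArc-neighbours (inj₁ st) _   t<n = proj₁ (shorterArc-step st t<n)
shorterArc-neighbours (inj₂ ts) s<n _   = proj₂ (shorterArc-step ts s<n)

shorterArc-descends-forward : ∀ {n s t} → suc s ≡ t → t ≤ n ∸ t →
                              suc (shorterArc n s) ≡ shorterArc n t
shorterArc-descends-forward {n} {s} refl t≤n∸t = begin
  suc (s ⊓ (n ∸ s))  ≡⟨ cong suc (m≤n⇒m⊓n≡m s≤n∸s) ⟩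
  suc s              ≡⟨ sym (m≤n⇒m⊓n≡m t≤n∸t) ⟩
  shorterArc n (suc s) ∎
  where
  open ≡-Reasoning
  s≤n∸s : s ≤ n ∸ s
  s≤n∸s = ≤-trans (n≤1+n s) (≤-trans t≤n∸t (∸-monoʳ-≤ n (n≤1+n s)))

shorterArc-descends-backward : ∀ {n t u} → CycleStep n t u → t < n → n ∸ t < t →
                               suc (shorterArc n u) ≡ shorterArc n t
shorterArc-descends-backward {n} {t} (inj₁ refl) t<n n∸t<t = begin
  suc (suc t ⊓ (n ∸ suc t)) ≡⟨ cong suc (m≥n⇒m⊓n≡n n∸[t+1]≤t+1) ⟩
  suc (n ∸ suc t)           ≡⟨ sym (m∸n≡1+[m∸1+n] t<n) ⟩
  n ∸ t                     ≡⟨ sym (m≥n⇒m⊓n≡n (<⇒≤ n∸t<t)) ⟩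
  shorterArc n t ∎
  where
  open ≡-Reasoning
  n∸[t+1]≤t+1 : n ∸ suc t ≤ suc t
  n∸[t+1]≤t+1 = ≤-trans (∸-monoʳ-≤ n (n≤1+n t)) (≤-trans (<⇒≤ n∸t<t) (n≤1+n t))
shorterArc-descends-backward {t = t} (inj₂ (refl , refl)) _ n∸t<t =
  sym (trans (cong (t ⊓_) (m+n∸n≡m 1 t)) (m≥n⇒m⊓n≡n (subst (_≤ t) (m+n∸n≡m 1 t) (<⇒≤ n∸t<t))))

-- Cycles and tori

CycleAdj⇒neighbours : ∀ {n} {i j : Fin n} → CycleAdj n i j → CycleNeighbours n (toℕ i) (toℕ j)
CycleAdj⇒neighbours (inj₁ e)                           = inj₁ (inj₁ e)
CycleAdj⇒neighbours (inj₂ (inj₁ e))                    = inj₂ (inj₁ e)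
CycleAdj⇒neighbours (inj₂ (inj₂ (inj₁ (i≡0 , j+1≡n)))) = inj₂ (inj₂ (j+1≡n , i≡0))
CycleAdj⇒neighbours (inj₂ (inj₂ (inj₂ (j≡0 , i+1≡n)))) = inj₁ (inj₂ (i+1≡n , j≡0))

step⇒CycleAdj : ∀ {n} {i j : Fin n} → CycleStep n (toℕ i) (toℕ j) → CycleAdj n i j
step⇒CycleAdj (inj₁ e)             = inj₁ e
step⇒CycleAdj (inj₂ (i+1≡n , j≡0)) = inj₂ (inj₂ (inj₂ (j≡0 , i+1≡n)))

step⇒CycleAdj˘ : ∀ {n} {i j : Fin n} → CycleStep n (toℕ i) (toℕ j) → CycleAdj n j i
step⇒CycleAdj˘ (inj₁ e)             = inj₂ (inj₁ e)
step⇒CycleAdj˘ (inj₂ (i+1≡n , j≡0)) = inj₂ (inj₂ (inj₁ (j≡0 , i+1≡n)))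

CycleStep-functional : ∀ {n x y y′} → y < n → y′ < n → CycleStep n x y → CycleStep n x y′ → y ≡ y′
CycleStep-functional _   _    (inj₁ refl)        (inj₁ refl)        = refl
CycleStep-functional y<n _    (inj₁ refl)        (inj₂ (x+1≡n , _)) = ⊥-elim (<-irrefl x+1≡n y<n)
CycleStep-functional _   y′<n (inj₂ (x+1≡n , _)) (inj₁ refl)        = ⊥-elim (<-irrefl x+1≡n y′<n)
CycleStep-functional _   _    (inj₂ (_ , refl))  (inj₂ (_ , refl))  = refl

CycleStep-injective : ∀ {n x x′ y} → CycleStep n x y → CycleStep n x′ y → x ≡ x′
CycleStep-injective (inj₁ refl)       (inj₁ e)        = suc-injective (sym e)
CycleStep-injective (inj₁ refl)       (inj₂ (_ , ()))
CycleStep-injective (inj₂ (_ , refl)) (inj₁ ())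
CycleStep-injective (inj₂ (e , _))    (inj₂ (e′ , _)) = suc-injective (trans e (sym e′))

Cycle-irreflexive : ∀ {n} → 2 ≤ n → (i : Fin n) → ¬ CycleAdj n i i
Cycle-irreflexive 2≤n i adj with CycleAdj⇒neighbours adj
... | inj₁ (inj₁ i+1≡i)         = 1+n≢n i+1≡i
... | inj₂ (inj₁ i+1≡i)         = 1+n≢n i+1≡i
... | inj₁ (inj₂ (i+1≡n , i≡0)) = <⇒≢ 2≤n (trans (cong suc (sym i≡0)) i+1≡n)
... | inj₂ (inj₂ (i+1≡n , i≡0)) = <⇒≢ 2≤n (trans (cong suc (sym i≡0)) i+1≡n)

next : ∀ {n} → Fin n → Fin n
next {n} i with suc (toℕ i) <? n
... | yes i+1<n = fromℕ< i+1<n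
... | no  _     = fromℕ< (≤-<-trans z≤n (toℕ<n i))

prev : ∀ {n} → Fin n → Fin n
prev {suc n} fzero    = fromℕ n
prev {suc n} (fsuc i) = inject₁ i

step-next : ∀ {n} (i : Fin n) → CycleStep n (toℕ i) (toℕ (next i))
step-next {n} i with suc (toℕ i) <? n
... | yes i+1<n = inj₁ (sym (toℕ-fromℕ< i+1<n))
... | no  i+1≮n = inj₂ (≤-antisym (toℕ<n i) (≮⇒≥ i+1≮n) , toℕ-fromℕ< _)

step-prev : ∀ {n} (i : Fin n) → CycleStep n (toℕ (prev i)) (toℕ i)
step-prev {suc n} fzero    = inj₂ (cong suc (toℕ-fromℕ n) , refl)
step-prev {suc n} (fsuc i) = inj₁ (cong suc (toℕ-inject₁ i))

CycleAdj⇒next⊎prev : ∀ {n} {i j : Fin n} → CycleAdj n i j → j ≡ next i ⊎ j ≡ prev i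
CycleAdj⇒next⊎prev {i = i} {j} adj with CycleAdj⇒neighbours adj
... | inj₁ i→j =
  inj₁ (toℕ-injective (CycleStep-functional (toℕ<n j) (toℕ<n (next i)) i→j (step-next i)))
... | inj₂ j→i = inj₂ (toℕ-injective (CycleStep-injective j→i (step-prev i)))

stepsTo : ∀ {n} → Fin n → Fin n → ℕ
stepsTo {n} i k = forward n (toℕ i) (toℕ k)

stepsTo-step : ∀ {n} {i j : Fin n} k → CycleStep n (toℕ i) (toℕ j) →
               CycleStep n (stepsTo j k) (stepsTo i k)
stepsTo-step {j = j} k i→j = forward-step (toℕ k) i→j (toℕ<n j) (toℕ<n k)

stepsTo-adj : ∀ {n} {i j : Fin n} k → CycleAdj n i j →
              CycleNeighbours n (stepsTo i k) (stepsTo j k)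
stepsTo-adj {i = i} {j} k adj =
  forward-neighbours (toℕ k) (CycleAdj⇒neighbours adj) (toℕ<n i) (toℕ<n j) (toℕ<n k)

stepsTo<n : ∀ {n} (i k : Fin n) → stepsTo i k < n
stepsTo<n i k = forward<n (toℕ<n i) (toℕ<n k)

cycleDist : ∀ n → Fin n → Fin n → ℕ
cycleDist n i k = shorterArc n (stepsTo i k)

cycleDist-refl : ∀ {n} (i : Fin n) → cycleDist n i i ≡ 0
cycleDist-refl {n} i = cong (shorterArc n) (forward-self n (toℕ i))

cycleDist-edge : ∀ {n} {i j : Fin n} k → CycleAdj n i j → cycleDist n i k ≤ suc (cycleDist n j k)
cycleDist-edge {i = i} {j} k adj =
  shorterArc-neighbours (stepsTo-adj k adj) (stepsTo<n i k) (stepsTo<n j k)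

cycleDist-descent : ∀ {n} (i k : Fin n) → i ≢ k →
                    Σ (Fin n) λ j → CycleAdj n i j × suc (cycleDist n j k) ≡ cycleDist n i k
cycleDist-descent {n} i k i≢k with stepsTo i k ≤? n ∸ stepsTo i k
... | no  t≰n∸t = prev i , step⇒CycleAdj˘ (step-prev i) ,
  shorterArc-descends-backward (stepsTo-step k (step-prev i)) (stepsTo<n i k) (≰⇒> t≰n∸t)
... | yes t≤n∸t with stepsTo-step k (step-next i)
...   | inj₁ closer     = next i , step⇒CycleAdj (step-next i) , shorterArc-descends-forward closer t≤n∸t
...   | inj₂ (_ , at-k) = ⊥-elim (i≢k (toℕ-injective (forward≡0⇒≡ (toℕ<n i) at-k)))

-- This is where n ≥ 5 is needed: on the 4-cycle, 2 is a second common neighbour of 1 and 3.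
¬neighbours-1-last : ∀ {n q} → 5 ≤ n → suc q ≡ n → ¬ CycleNeighbours n 1 q
¬neighbours-1-last (s≤s (s≤s (s≤s (s≤s (s≤s _))))) refl (inj₁ (inj₁ ()))
¬neighbours-1-last (s≤s (s≤s (s≤s (s≤s (s≤s _))))) refl (inj₁ (inj₂ (() , _)))
¬neighbours-1-last (s≤s (s≤s (s≤s (s≤s (s≤s _))))) refl (inj₂ (inj₁ ()))
¬neighbours-1-last (s≤s (s≤s (s≤s (s≤s (s≤s _))))) refl (inj₂ (inj₂ (_ , ())))

neighbours-1-last⇒0 : ∀ {n q c} → 5 ≤ n → suc q ≡ n →
                      CycleNeighbours n 1 c → CycleNeighbours n c q → c ≡ 0
neighbours-1-last⇒0 (s≤s (s≤s (s≤s (s≤s (s≤s _))))) refl (inj₁ (inj₁ refl)) (inj₁ (inj₁ ()))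
neighbours-1-last⇒0 (s≤s (s≤s (s≤s (s≤s (s≤s _))))) refl (inj₁ (inj₁ refl)) (inj₁ (inj₂ (() , _)))
neighbours-1-last⇒0 (s≤s (s≤s (s≤s (s≤s (s≤s _))))) refl (inj₁ (inj₁ refl)) (inj₂ (inj₁ ()))
neighbours-1-last⇒0 (s≤s (s≤s (s≤s (s≤s (s≤s _))))) refl (inj₁ (inj₁ refl)) (inj₂ (inj₂ (_ , ())))
neighbours-1-last⇒0 (s≤s (s≤s (s≤s (s≤s (s≤s _))))) refl (inj₁ (inj₂ (() , _))) _
neighbours-1-last⇒0 _ _ (inj₂ (inj₁ refl))     _ = refl
neighbours-1-last⇒0 _ _ (inj₂ (inj₂ (_ , ()))) _

Cycle-UniqueMiddle : ∀ {n} → 5 ≤ n → (a : Fin n) → UniqueMiddle (Cycle n) (prev a) a (next a)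
Cycle-UniqueMiddle {n} 5≤n a = record
  { ends-distinct = λ prev≡next → <⇒≢ (≤-trans (s≤s (s≤s (s≤s z≤n))) 5≤n)
      (trans (cong suc (sym prev↦1)) (trans (cong (λ j → suc (stepsTo j a)) prev≡next) next↦n-1))
  ; ends-nonadj   = λ adj → ¬neighbours-1-last 5≤n next↦n-1 (from-prev (stepsTo-adj a adj))
  ; left          = step⇒CycleAdj (step-prev a)
  ; right         = step⇒CycleAdj (step-next a)
  ; unique        = λ c prev~c c~next → toℕ-injective (forward≡0⇒≡ (toℕ<n c)
      (neighbours-1-last⇒0 5≤n next↦n-1 (from-prev (stepsTo-adj a prev~c)) (stepsTo-adj a c~next)))
  }
  where
  a↦0 : stepsTo a a ≡ 0
  a↦0 = forward-self n (toℕ a)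
  prev↦1 : stepsTo (prev a) a ≡ 1
  prev↦1 with subst (λ t → CycleStep n t (stepsTo (prev a) a)) a↦0 (stepsTo-step a (step-prev a))
  ... | inj₁ 1≡t       = sym 1≡t
  ... | inj₂ (1≡n , _) = ⊥-elim (<⇒≢ (≤-trans (s≤s (s≤s z≤n)) 5≤n) 1≡n)
  next↦n-1 : suc (stepsTo (next a) a) ≡ n
  next↦n-1 with subst (CycleStep n (stepsTo (next a) a)) a↦0 (stepsTo-step a (step-next a))
  ... | inj₂ (t+1≡n , _) = t+1≡n
  from-prev : ∀ {t} → CycleNeighbours n (stepsTo (prev a) a) t → CycleNeighbours n 1 t
  from-prev = subst (λ s → CycleNeighbours n s _) prev↦1

torusDist : ∀ n m → Fin n × Fin m → Fin n × Fin m → ℕ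
torusDist n m = □-dist {Cycle n} {Cycle m} (cycleDist n) (cycleDist m)

module Torus (n m : ℕ) where
  open Potential (Cycle n □ Cycle m) (torusDist n m)
    (□-dist-refl {Cycle n} {Cycle m} (cycleDist n) (cycleDist m) cycleDist-refl cycleDist-refl)
    (□-dist-edge {Cycle n} {Cycle m} (cycleDist n) (cycleDist m)
      (λ {i} {j} → cycleDist-edge {i = i} {j}) (λ {i} {j} → cycleDist-edge {i = i} {j})) public
  open Geodesics (≡-dec Fin._≟_ Fin._≟_)
    (□-dist-descent {Cycle n} {Cycle m} (cycleDist n) (cycleDist m) Fin._≟_
      cycleDist-descent cycleDist-descent) public

IsMuT-largeTorus : ∀ {n m} → 5 ≤ n → 2 ≤ m → IsMuT (Cycle n □ Cycle m) 0
IsMuT-largeTorus {n} {m} 5≤n 2≤m = IsMuT-zero (Torus.shortestPath n m) λ where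
  (a , b) → (prev a , b) , (next a , b) ,
            □-UniqueMiddle b (Cycle-UniqueMiddle 5≤n a) (Cycle-irreflexive 2≤m b)

torusNeighbours : ∀ {n m} → Fin n × Fin m → List (Fin n × Fin m)
torusNeighbours (a , b) = (next a , b) ∷ (prev a , b) ∷ (a , next b) ∷ (a , prev b) ∷ []

torusNeighbours-sound : ∀ {n m} {u w : Fin n × Fin m} →
                        w ∈ torusNeighbours u → Adj (Cycle n □ Cycle m) u w
torusNeighbours-sound {u = a , b} (here refl)                         = inj₂ (step⇒CycleAdj (step-next a) , refl)
torusNeighbours-sound {u = a , b} (there (here refl))                 = inj₂ (step⇒CycleAdj˘ (step-prev a) , refl)
torusNeighbours-sound {u = a , b} (there (there (here refl)))         = inj₁ (refl , step⇒CycleAdj (step-next b))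
torusNeighbours-sound {u = a , b} (there (there (there (here refl)))) = inj₁ (refl , step⇒CycleAdj˘ (step-prev b))

torusNeighbours-complete : ∀ {n m} {u w : Fin n × Fin m} →
                           Adj (Cycle n □ Cycle m) u w → w ∈ torusNeighbours u
torusNeighbours-complete (inj₂ (aa′ , refl)) with CycleAdj⇒next⊎prev aa′
... | inj₁ refl = here refl
... | inj₂ refl = there (here refl)
torusNeighbours-complete (inj₁ (refl , bb′)) with CycleAdj⇒next⊎prev bb′
... | inj₁ refl = there (there (here refl))
... | inj₂ refl = there (there (there (here refl)))

-- Any probe pairs give a sound compatibility test; these three suffice for the small tori.
torusProbes : ∀ {n m} → Fin n × Fin m → Fin n × Fin m → List ((Fin n × Fin m) × (Fin n × Fin m))
torusProbes (a₁ , a₂) (b₁ , b₂) =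
  ((a₁ , b₂) , (b₁ , a₂)) ∷ ((next a₁ , a₂) , (prev a₁ , a₂)) ∷ ((a₁ , next a₂) , (a₁ , prev a₂))
  ∷ []

module TorusSearch (n m : ℕ) = DecidableMuT (Cycle n □ Cycle m) (≡-dec Fin._≟_ Fin._≟_)
  (cartesianProduct (allFin n) (allFin m))
  (λ (a , b) → ∈-cartesianProduct⁺ (∈-allFin a) (∈-allFin b))
  (Torus.visible? n m torusNeighbours torusNeighbours-sound torusNeighbours-complete)
  torusProbes

IsMuT-3×3 : IsMuT (Cycle 3 □ Cycle 3) 3
IsMuT-3×3 = TorusSearch.IsMuT-bySearch 3 3 ((# 0 , # 0) ∷ (# 0 , # 1) ∷ (# 0 , # 2) ∷ []) _ _

IsMuT-4×3 : IsMuT (Cycle 4 □ Cycle 3) 3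
IsMuT-4×3 = TorusSearch.IsMuT-bySearch 4 3 ((# 0 , # 0) ∷ (# 0 , # 1) ∷ (# 0 , # 2) ∷ []) _ _

IsMuT-4×4 : IsMuT (Cycle 4 □ Cycle 4) 4
IsMuT-4×4 =
  TorusSearch.IsMuT-bySearch 4 4 ((# 0 , # 0) ∷ (# 0 , # 1) ∷ (# 2 , # 2) ∷ (# 2 , # 3) ∷ []) _ _

theorem4p7 : (n m : ℕ) → 3 ≤ m → m ≤ n → IsMuT (Cycle n □ Cycle m) (expected n m)
theorem4p7 3 3 _ _ = IsMuT-3×3
theorem4p7 4 3 _ _ = IsMuT-4×3
theorem4p7 4 4 _ _ = IsMuT-4×4
theorem4p7 (suc (suc (suc (suc (suc _))))) _ 3≤m _ =
  IsMuT-largeTorus (s≤s (s≤s (s≤s (s≤s (s≤s z≤n))))) (≤-trans (n≤1+n 2) 3≤m)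
theorem4p7 _ 0 () _
theorem4p7 _ 1 (s≤s ()) _
theorem4p7 _ 2 (s≤s (s≤s ())) _
theorem4p7 0 (suc _) _ ()
theorem4p7 1 (suc (suc _)) _ (s≤s ())
theorem4p7 2 (suc (suc (suc _))) _ (s≤s (s≤s ()))
theorem4p7 3 (suc (suc (suc (suc _)))) _ (s≤s (s≤s (s≤s ())))
theorem4p7 4 (suc (suc (suc (suc (suc _))))) _ (s≤s (s≤s (s≤s (s≤s ()))))
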